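{- The strong negation ${\sim}$ is definable in $\mathrm{2Int}$ via the formula $$(A \wedge (A \rightarrow (A \prec A))) \vee ((A \rightarrow A) \prec A).$$ That is, writing ${\sim}A$ for this formula, the four rules ${\sim}I^+$, ${\sim}I^-$, ${\sim}E^+$, ${\sim}E^-$ are derivable in $\mathrm{2Int}$.
   Context: $\mathrm{2Int}$ is Wansing's bi-intuitionistic logic, a constructive logic with two forms of derivation: proofs (written with single inference lines) and dual proofs (written with double inference lines). Its language is $A ::= p \mid \top \mid \bot \mid A\wedge A \mid A\vee A \mid A\to A \mid A \prec A$, where $\prec$ denotes the co-implication. Assumptions may be discharged in proofs and counter-assumptions in dual proofs. The natural deduction rules of $\mathrm{2Int}$ are as follows (a "proof of $X$" means a derivation ending in $X$ with a single line, a "dual proof of $X$" one ending with a double line; in rules marked "proof-or-dual", all marked premises and the conclusion are uniformly proofs or uniformly dual proofs). Proof rules: $\wedge I^+$: from proofs of $A$ and $B$, a proof of $A\wedge B$; $\wedge E^+_{1,2}$: from a proof of $A\wedge B$, a proof of $A$ (resp. $B$). $\vee I^+_{1,2}$: from a proof of $A$ (resp. $B$), a proof of $A\vee B$; $\vee E^+$: from a proof of $A\vee B$, a derivation of $C$ from assumption $A$ and a derivation of $C$ from assumption $B$ (proof-or-dual), conclude $C$ (same kind), discharging the assumptions. $\to I^+$: from a proof of $B$ from assumption $A$, a proof of $A\to B$ (discharging $A$); $\to E^+$: from proofs of $A\to B$ and $A$, a proof of $B$. $\prec I^+$: from a proof of $A$ and a dual proof of $B$, a proof of $A\prec B$; $\prec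 E^+_1$: from a proof of $A\prec B$, a proof of $A$; $\prec E^+_2$: from a proof of $A\prec B$, a dual proof of $B$. $\top I^+$: a proof of $\top$; $\bot E^+$: from a proof of $\bot$, a proof or dual proof of any $A$. Dual-proof rules: $\wedge I^-_{1,2}$: from a dual proof of $A$ (resp. $B$), a dual proof of $A\wedge B$; $\wedge E^-$: from a dual proof of $A\wedge B$, a derivation of $C$ from counter-assumption $A$ and one of $C$ from counter-assumption $B$ (proof-or-dual), conclude $C$ (same kind), discharging. $\vee I^-$: from dual proofs of $A$ and $B$, a dual proof of $A\vee B$; $\vee E^-_{1,2}$: from a dual proof of $A\vee B$, a dual proof of $A$ (resp. $B$). $\to I^-$: from a proof of $A$ and a dual proof of $B$, a dual proof of $A\to B$; $\to E^-_1$: from a dual proof of $A\to B$, a proof of $A$; $\to E^-_2$: from a dual proof of $A\to B$, a dual proof of $B$. $\prec I^-$: from a dual proof of $A$ from counter-assumption $B$, a dual proof of $A\prec B$ (discharging $B$); $\prec E^-$: from dual proofs of $A\prec B$ and $B$, a dual proof of $A$. $\top E^-$: from a dual proof of $\top$, a proof or dual proof of any $A$; $\bot I^-$: a dual proof of $\bot$. Strong negation ${\sim}$ (from Nelson's logic N4) is governed in this bilateral setting by: ${\sim}I^+$: from a dual proof of $A$, a proof of ${\sim}A$; ${\sim}I^-$: from a proof of $A$, a dual proof of ${\sim}A$; ${\sim}E^+$: from a proof of ${\sim}A$, a dual proof of $A$; ${\sim}E^-$: from a dual proof of ${\sim}A$, a proof of $A$. -}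

module Defs where

open import Data.Nat using (ℕ)
open import Data.List using (List; _∷_)
open import Data.List.Membership.Propositional using (_∈_)

infixr 6 _∧'_
infixr 5 _∨'_
infixr 4 _⇒_
infixl 7 _≺_

data Fm : Set where
  atom : ℕ → Fm
  ⊤'   : Fm
  ⊥'   : Fm
  _∧'_ : Fm → Fm → Fm
  _∨'_ : Fm → Fm → Fm
  _⇒_  : Fm → Fm → Fm
  _≺_  : Fm → Fm → Fm

-- Kind of derivation: proof (single line) or dual proof (double line).
data Pol : Set where
  pf   : Pol
  dual : Pol

-- Γ ⨾ Δ ⊢[ pf ] A   : a proof of A from open assumptions Γ and
--                      open counter-assumptions Δ.
-- Γ ⨾ Δ ⊢[ dual ] A : a dual proof of A from the same.
-- Discharging an assumption/counter-assumption = extending Γ/Δ in a premise.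
data _⨾_⊢[_]_ : List Fm → List Fm → Pol → Fm → Set where
  ass   : ∀ {Γ Δ A} → A ∈ Γ → Γ ⨾ Δ ⊢[ pf ] A
  cass  : ∀ {Γ Δ A} → A ∈ Δ → Γ ⨾ Δ ⊢[ dual ] A
  ∧I⁺   : ∀ {Γ Δ A B} → Γ ⨾ Δ ⊢[ pf ] A → Γ ⨾ Δ ⊢[ pf ] B → Γ ⨾ Δ ⊢[ pf ] (A ∧' B)
  ∧E⁺₁  : ∀ {Γ Δ A B} → Γ ⨾ Δ ⊢[ pf ] (A ∧' B) → Γ ⨾ Δ ⊢[ pf ] A
  ∧E⁺₂  : ∀ {Γ Δ A B} → Γ ⨾ Δ ⊢[ pf ] (A ∧' B) → Γ ⨾ Δ ⊢[ pf ] B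
  ∨I⁺₁  : ∀ {Γ Δ A B} → Γ ⨾ Δ ⊢[ pf ] A → Γ ⨾ Δ ⊢[ pf ] (A ∨' B)
  ∨I⁺₂  : ∀ {Γ Δ A B} → Γ ⨾ Δ ⊢[ pf ] B → Γ ⨾ Δ ⊢[ pf ] (A ∨' B)
  ∨E⁺   : ∀ {Γ Δ A B C p} → Γ ⨾ Δ ⊢[ pf ] (A ∨' B) →
            (A ∷ Γ) ⨾ Δ ⊢[ p ] C → (B ∷ Γ) ⨾ Δ ⊢[ p ] C → Γ ⨾ Δ ⊢[ p ] C
  ⇒I⁺   : ∀ {Γ Δ A B} → (A ∷ Γ) ⨾ Δ ⊢[ pf ] B → Γ ⨾ Δ ⊢[ pf ] (A ⇒ B)
  ⇒E⁺   : ∀ {Γ Δ A B} → Γ ⨾ Δ ⊢[ pf ] (A ⇒ B) → Γ ⨾ Δ ⊢[ pf ] A → Γ ⨾ Δ ⊢[ pf ] B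
  ≺I⁺   : ∀ {Γ Δ A B} → Γ ⨾ Δ ⊢[ pf ] A → Γ ⨾ Δ ⊢[ dual ] B → Γ ⨾ Δ ⊢[ pf ] (A ≺ B)
  ≺E⁺₁  : ∀ {Γ Δ A B} → Γ ⨾ Δ ⊢[ pf ] (A ≺ B) → Γ ⨾ Δ ⊢[ pf ] A
  ≺E⁺₂  : ∀ {Γ Δ A B} → Γ ⨾ Δ ⊢[ pf ] (A ≺ B) → Γ ⨾ Δ ⊢[ dual ] B
  ⊤I⁺   : ∀ {Γ Δ} → Γ ⨾ Δ ⊢[ pf ] ⊤'
  ⊥E⁺   : ∀ {Γ Δ A p} → Γ ⨾ Δ ⊢[ pf ] ⊥' → Γ ⨾ Δ ⊢[ p ] A
  ∧I⁻₁  : ∀ {Γ Δ A B} → Γ ⨾ Δ ⊢[ dual ] A → Γ ⨾ Δ ⊢[ dual ] (A ∧' B)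
  ∧I⁻₂  : ∀ {Γ Δ A B} → Γ ⨾ Δ ⊢[ dual ] B → Γ ⨾ Δ ⊢[ dual ] (A ∧' B)
  ∧E⁻   : ∀ {Γ Δ A B C p} → Γ ⨾ Δ ⊢[ dual ] (A ∧' B) →
            Γ ⨾ (A ∷ Δ) ⊢[ p ] C → Γ ⨾ (B ∷ Δ) ⊢[ p ] C → Γ ⨾ Δ ⊢[ p ] C
  ∨I⁻   : ∀ {Γ Δ A B} → Γ ⨾ Δ ⊢[ dual ] A → Γ ⨾ Δ ⊢[ dual ] B → Γ ⨾ Δ ⊢[ dual ] (A ∨' B)
  ∨E⁻₁  : ∀ {Γ Δ A B} → Γ ⨾ Δ ⊢[ dual ] (A ∨' B) → Γ ⨾ Δ ⊢[ dual ] A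
  ∨E⁻₂  : ∀ {Γ Δ A B} → Γ ⨾ Δ ⊢[ dual ] (A ∨' B) → Γ ⨾ Δ ⊢[ dual ] B
  ⇒I⁻   : ∀ {Γ Δ A B} → Γ ⨾ Δ ⊢[ pf ] A → Γ ⨾ Δ ⊢[ dual ] B → Γ ⨾ Δ ⊢[ dual ] (A ⇒ B)
  ⇒E⁻₁  : ∀ {Γ Δ A B} → Γ ⨾ Δ ⊢[ dual ] (A ⇒ B) → Γ ⨾ Δ ⊢[ pf ] A
  ⇒E⁻₂  : ∀ {Γ Δ A B} → Γ ⨾ Δ ⊢[ dual ] (A ⇒ B) → Γ ⨾ Δ ⊢[ dual ] B
  ≺I⁻   : ∀ {Γ Δ A B} → Γ ⨾ (B ∷ Δ) ⊢[ dual ] A → Γ ⨾ Δ ⊢[ dual ] (A ≺ B)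
  ≺E⁻   : ∀ {Γ Δ A B} → Γ ⨾ Δ ⊢[ dual ] (A ≺ B) → Γ ⨾ Δ ⊢[ dual ] B → Γ ⨾ Δ ⊢[ dual ] A
  ⊤E⁻   : ∀ {Γ Δ A p} → Γ ⨾ Δ ⊢[ dual ] ⊤' → Γ ⨾ Δ ⊢[ p ] A
  ⊥I⁻   : ∀ {Γ Δ} → Γ ⨾ Δ ⊢[ dual ] ⊥'

∼_ : Fm → Fm
∼ A = (A ∧' (A ⇒ (A ≺ A))) ∨' ((A ⇒ A) ≺ A)

-- A dual proof of A makes (A → A) ≺ A provable, and a proof of A refutes
-- both disjuncts (A → (A ≺ A) through its subtrahend A ≺ A, (A → A) ≺ A
-- directly). Conversely, each disjunct of a proved ∼ A yields A ≺ A or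
-- (A → A) ≺ A and hence a dual proof of A; a dual proof of ∼ A refutes
-- A ∧ (A → (A ≺ A)), and in either case of that refutation a proof of A
-- comes from a refuted implication with antecedent A, the case of the
-- counter-assumption A using the refutation of (A → A) ≺ A.
module Submission where

open import Defs
open import Data.List using (List; _∷_)
open import Data.List.Relation.Binary.Subset.Propositional using (_⊆_)
open import Data.List.Relation.Binary.Subset.Propositional.Properties
  using (⊆-refl; xs⊆x∷xs; ∷⁺ʳ)
open import Data.List.Relation.Unary.Any using (here)
open import Data.Product using (_×_; _,_)
open import Relation.Binary.PropositionalEquality using (refl)

weaken : ∀ {Γ Γ' Δ Δ' p A} → Γ ⊆ Γ' → Δ ⊆ Δ' → Γ ⨾ Δ ⊢[ p ] A → Γ' ⨾ Δ' ⊢[ p ] A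
weaken f g (ass x)     = ass (f x)
weaken f g (cass x)    = cass (g x)
weaken f g (∧I⁺ d e)   = ∧I⁺ (weaken f g d) (weaken f g e)
weaken f g (∧E⁺₁ d)    = ∧E⁺₁ (weaken f g d)
weaken f g (∧E⁺₂ d)    = ∧E⁺₂ (weaken f g d)
weaken f g (∨I⁺₁ d)    = ∨I⁺₁ (weaken f g d)
weaken f g (∨I⁺₂ d)    = ∨I⁺₂ (weaken f g d)
weaken f g (∨E⁺ d e h) = ∨E⁺ (weaken f g d) (weaken (∷⁺ʳ _ f) g e) (weaken (∷⁺ʳ _ f) g h)
weaken f g (⇒I⁺ d)     = ⇒I⁺ (weaken (∷⁺ʳ _ f) g d)
weaken f g (⇒E⁺ d e)   = ⇒E⁺ (weaken f g d) (weaken f g e)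
weaken f g (≺I⁺ d e)   = ≺I⁺ (weaken f g d) (weaken f g e)
weaken f g (≺E⁺₁ d)    = ≺E⁺₁ (weaken f g d)
weaken f g (≺E⁺₂ d)    = ≺E⁺₂ (weaken f g d)
weaken f g ⊤I⁺         = ⊤I⁺
weaken f g (⊥E⁺ d)     = ⊥E⁺ (weaken f g d)
weaken f g (∧I⁻₁ d)    = ∧I⁻₁ (weaken f g d)
weaken f g (∧I⁻₂ d)    = ∧I⁻₂ (weaken f g d)
weaken f g (∧E⁻ d e h) = ∧E⁻ (weaken f g d) (weaken f (∷⁺ʳ _ g) e) (weaken f (∷⁺ʳ _ g) h)
weaken f g (∨I⁻ d e)   = ∨I⁻ (weaken f g d) (weaken f g e)
weaken f g (∨E⁻₁ d)    = ∨E⁻₁ (weaken f g d)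
weaken f g (∨E⁻₂ d)    = ∨E⁻₂ (weaken f g d)
weaken f g (⇒I⁻ d e)   = ⇒I⁻ (weaken f g d) (weaken f g e)
weaken f g (⇒E⁻₁ d)    = ⇒E⁻₁ (weaken f g d)
weaken f g (⇒E⁻₂ d)    = ⇒E⁻₂ (weaken f g d)
weaken f g (≺I⁻ d)     = ≺I⁻ (weaken f (∷⁺ʳ _ g) d)
weaken f g (≺E⁻ d e)   = ≺E⁻ (weaken f g d) (weaken f g e)
weaken f g (⊤E⁻ d)     = ⊤E⁻ (weaken f g d)
weaken f g ⊥I⁻         = ⊥I⁻

weaken-counter : ∀ {Γ Δ p A} B → Γ ⨾ Δ ⊢[ p ] A → Γ ⨾ (B ∷ Δ) ⊢[ p ] A
weaken-counter B = weaken ⊆-refl (xs⊆x∷xs _ B)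

module _ {Γ Δ : List Fm} {A : Fm} where

  ∼I⁺ : Γ ⨾ Δ ⊢[ dual ] A → Γ ⨾ Δ ⊢[ pf ] (∼ A)
  ∼I⁺ d = ∨I⁺₂ (≺I⁺ (⇒I⁺ (ass (here refl))) d)

  ∼I⁻ : Γ ⨾ Δ ⊢[ pf ] A → Γ ⨾ Δ ⊢[ dual ] (∼ A)
  ∼I⁻ a = ∨I⁻ (∧I⁻₂ (⇒I⁻ a (≺I⁻ (cass (here refl)))))
              (≺I⁻ (⇒I⁻ (weaken-counter A a) (cass (here refl))))

  ∼E⁺ : Γ ⨾ Δ ⊢[ pf ] (∼ A) → Γ ⨾ Δ ⊢[ dual ] A
  ∼E⁺ d = ∨E⁺ d (≺E⁺₂ (⇒E⁺ (∧E⁺₂ (ass (here refl))) (∧E⁺₁ (ass (here refl)))))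
                (≺E⁺₂ (ass (here refl)))

  ∼E⁻ : Γ ⨾ Δ ⊢[ dual ] (∼ A) → Γ ⨾ Δ ⊢[ pf ] A
  ∼E⁻ d = ∧E⁻ (∨E⁻₁ d)
              (⇒E⁻₁ (≺E⁻ (∨E⁻₂ (weaken-counter A d)) (cass (here refl))))
              (⇒E⁻₁ (cass (here refl)))

mainTheorem1 : (Γ Δ : List Fm) (A : Fm) →
    ((Γ ⨾ Δ ⊢[ dual ] A → Γ ⨾ Δ ⊢[ pf ] (∼ A)) ×
    (Γ ⨾ Δ ⊢[ pf ] A → Γ ⨾ Δ ⊢[ dual ] (∼ A)) ×
    (Γ ⨾ Δ ⊢[ pf ] (∼ A) → Γ ⨾ Δ ⊢[ dual ] A) ×
    (Γ ⨾ Δ ⊢[ dual ] (∼ A) → Γ ⨾ Δ ⊢[ pf ] A))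
mainTheorem1 Γ Δ A = ∼I⁺ , ∼I⁻ , ∼E⁺ , ∼E⁻
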